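{- Let $r,s,k,n$ be positive integers with $r \geq 2$. Then there exists a hypergraph $\mathcal{H}$ with vertex set $[n]$ such that $\chi\left(\mathrm{KG}^r(\mathcal{H}_{s\text{ -stable}})\right) = 0$ and $\left\lceil \frac{\mathrm{cd}^r(\mathcal{H})}{r-1} \right\rceil \geq k$ if and only if the graph $\mathcal{F}_n^s$ satisfies $\chi\left(\mathrm{KG}^r((\mathcal{F}_n^s)_{s\text{ -stable}})\right) = 0$ and $\left\lceil \frac{\mathrm{cd}^r(\mathcal{F}_n^s)}{r-1} \right\rceil \geq k$.
   Context: $[n]=\{1,\dots,n\}$. A hypergraph $\mathcal{H}$ on vertex set $V$ is a family $E(\mathcal{H})$ of nonempty subsets of $V$ (hyperedges); a graph is a hypergraph all of whose hyperedges have size 2. A set $S \subseteq [n]$ is $s$-stable if any two distinct $i,j \in S$ satisfy $s \leq |i-j| \leq n-s$. For a hypergraph $\mathcal{H}$ on $[n]$, $\mathcal{H}_{s\text{ -stable}}$ denotes the hypergraph on $[n]$ whose hyperedges are the $s$-stable hyperedges of $\mathcal{H}$. $\mathcal{F}_n^s$ is the graph with vertex set $[n]$ whose edges are exactly the 2-element subsets of $[n]$ that are not $s$-stable. For a hypergraph $\mathcal{F}$ and $r\ge 2$, the general Kneser hypergraph $\mathrm{KG}^r(\mathcal{F})$ has vertex set $E(\mathcal{F})$, and its hyperedges are the sets of $r$ pairwise disjoint hyperedges of $\mathcal{F}$. The chromatic number $\chi$ of a hypergraph is the least number of colors in a vertex coloring with no monochromatic hyperedge (it is $0$ when the vertex set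 is empty). The $r$-colorability defect $\mathrm{cd}^r(\mathcal{H})$ is the minimum size of a set $S \subseteq V(\mathcal{H})$ such that the induced subhypergraph on $V(\mathcal{H})\setminus S$ (whose hyperedges are the hyperedges of $\mathcal{H}$ contained in $V(\mathcal{H})\setminus S$) admits a vertex coloring with at most $r$ colors having no monochromatic hyperedge. -}

module Defs where

open import Level using (Level; suc; zero)
open import Data.Nat using (ℕ; _≤_; _+_; _∸_; _/_; ∣_-_∣)
import Data.Nat as N
open import Data.Fin using (Fin; toℕ)
open import Data.Fin.Subset using (Subset; _∈_; _∉_; _∩_; ∣_∣; Nonempty; Empty)
open import Data.Fin.Subset.Properties using (nonempty?; Empty-unique; ∣⊥∣≡0)
open import Data.Product using (Σ; ∃; ∃-syntax; _×_; _,_; proj₁)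
open import Relation.Nullary using (¬_; yes; no)
open import Relation.Binary.PropositionalEquality using (_≡_; _≢_; subst; sym; trans; cong)
open import Data.Empty using (⊥-elim)

record Hyp : Set₁ where
  field
    Vertex : Set
    HEdge  : Set
    _∈ₕ_   : Vertex → HEdge → Set

open Hyp public

Proper : (G : Hyp) (m : ℕ) → (Vertex G → Fin m) → Set
Proper G m c = (e : HEdge G) →
  ¬ (∀ v w → _∈ₕ_ G v e → _∈ₕ_ G w e → c v ≡ c w)

Colorable : Hyp → ℕ → Set
Colorable G m = Σ (Vertex G → Fin m) (Proper G m)

-- χ is the least number of colours of a proper colouring
-- (a proper 0-colouring exists exactly when the vertex set is empty)
IsChromaticNumber : Hyp → ℕ → Set
IsChromaticNumber G χ = Colorable G χ × (∀ m → Colorable G m → χ ≤ m)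

-- Hypergraphs on [n] (vertex i ∈ [n] is represented by the element of Fin n
-- with toℕ = i - 1).  A hyperedge is a nonempty subset of [n].

record Hypergraph (n : ℕ) : Set₁ where
  field
    edge     : Subset n → Set
    nonempty : ∀ {A} → edge A → Nonempty A

open Hypergraph public

Edge : ∀ {n} → Hypergraph n → Set
Edge H = Σ (Subset _) (edge H)

Stable : (n s : ℕ) → Subset n → Set
Stable n s S = ∀ (i j : Fin n) → i ∈ S → j ∈ S → i ≢ j →
  s ≤ ∣ toℕ i - toℕ j ∣ × ∣ toℕ i - toℕ j ∣ ≤ n ∸ s

stablePart : ∀ {n} (s : ℕ) → Hypergraph n → Hypergraph n
stablePart {n} s H = record
  { edge     = λ A → edge H A × Stable n s A
  ; nonempty = λ { (e , _) → nonempty H e } }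

∣∣≡2⇒nonempty : ∀ {n} (A : Subset n) → ∣ A ∣ ≡ 2 → Nonempty A
∣∣≡2⇒nonempty {n} A eq with nonempty? A
... | yes ne = ne
... | no ¬ne with trans (sym eq) (trans (cong ∣_∣ (Empty-unique ¬ne)) (∣⊥∣≡0 n))
... | ()

F : (n s : ℕ) → Hypergraph n
F n s = record
  { edge     = λ A → ∣ A ∣ ≡ 2 × ¬ Stable n s A
  ; nonempty = λ {A} e → ∣∣≡2⇒nonempty A (proj₁ e) }

-- the general Kneser hypergraph KG^r(H): vertices are the hyperedges of H,
-- hyperedges are the r-sets of pairwise disjoint hyperedges of H (given by an
-- enumeration Fin r → E(H); pairwise disjoint nonempty sets are distinct).
KG : ∀ {n} (r : ℕ) → Hypergraph n → Hyp
KG {n} r H = record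
  { Vertex = Edge H
  ; HEdge  = Σ (Fin r → Edge H) λ e →
               ∀ i j → i ≢ j → Empty (proj₁ (e i) ∩ proj₁ (e j))
  ; _∈ₕ_   = λ v f → ∃[ i ] proj₁ f i ≡ v }

-- the subhypergraph induced on [n] \ S admits a proper colouring with
-- at most r colours (colours Fin r; values on S are irrelevant)
ColorableOutside : ∀ {n} → Hypergraph n → (r : ℕ) → Subset n → Set
ColorableOutside {n} H r S = Σ (Fin n → Fin r) λ c →
  (A : Subset n) → edge H A → (∀ v → v ∈ A → v ∉ S) →
  ¬ (∀ v w → v ∈ A → w ∈ A → c v ≡ c w)

IsColorabilityDefect : ∀ {n} → (r : ℕ) → Hypergraph n → ℕ → Set
IsColorabilityDefect {n} r H d =
  (Σ (Subset n) λ S → ∣ S ∣ ≡ d × ColorableOutside H r S) ×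
  (∀ S → ColorableOutside H r S → d ≤ ∣ S ∣)

-- ⌈ d / m ⌉ for m ≥ 1 (junk value 0 for m = 0)
ceilDiv : ℕ → ℕ → ℕ
ceilDiv d ℕ.zero    = 0
ceilDiv d (ℕ.suc m) = (d + m) / ℕ.suc m

Cond : ∀ {n} (r s k : ℕ) → Hypergraph n → Set
Cond r s k H =
  IsChromaticNumber (KG r (stablePart s H)) 0 ×
  (∃[ d ] IsColorabilityDefect r H d × k ≤ ceilDiv d (r ∸ 1))

{-# OPTIONS --safe #-}
module Submission where

-- A hypergraph H on [n] with χ(KG^r(H_{s-stable})) = 0 has no s-stable hyperedge, since
-- such a hyperedge would be a vertex of the Kneser hypergraph.  Every hyperedge of H
-- therefore contains two distinct vertices at unstable distance, i.e. an edge of F_n^s,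
-- so every colouring that is proper on F_n^s outside S is proper on H outside S.  Hence
-- cd^r(H) ≤ cd^r(F_n^s); the condition on χ holds for F_n^s by definition, and the
-- ceiling is monotone.  The converse is witnessed by H = F_n^s.  Constructively, the
-- existence of cd^r(F_n^s) needs a proof that colourability of F_n^s outside S is
-- decidable, which is a finite search over all colourings.

open import Defs
open import Data.Nat using (ℕ; zero; suc; _≤_; _∸_; z≤n; s≤s; _≤?_; ∣_-_∣)
  renaming (_≟_ to _≟ℕ_)
open import Data.Nat.Properties using (≤-trans; +-monoˡ-≤)
open import Data.Nat.DivMod using (/-monoˡ-≤)
open import Data.Product using (∃; ∃-syntax; _×_; _,_; proj₂)
open import Data.Sum using (_⊎_; inj₁; inj₂)
import Data.Sum as Sum
open import Data.Empty using (⊥-elim)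
open import Data.Fin using (Fin; zero; suc; toℕ; _≟_)
open import Data.Fin.Properties using (any?; all?)
open import Data.Fin.Subset using (Subset; _∈_; _∉_; _∪_; ⁅_⁆; ⊤; ∣_∣)
open import Data.Fin.Subset.Properties
  using ( _∈?_; ∈⊤; ∣⊤∣≡n; ∣⁅x⁆∣≡1; x∈⁅x⁆; x∈⁅y⁆⇒x≡y; x∈p∪q⁺; x∈p∪q⁻
        ; ∪-identityˡ; ∪-identityʳ; anySubset?)
open import Data.Vec.Functional using (_∷_; head; tail)
open import Function using (_∘_)
open import Function.Bundles using (_⇔_; mk⇔)
open import Relation.Nullary using (¬_; Dec; yes; no)
open import Relation.Nullary.Decidable using (¬?; _×-dec_; _→-dec_; map′; decidable-stable)
open import Relation.Unary using (Decidable)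
open import Relation.Binary.PropositionalEquality
  using (_≡_; _≢_; _≗_; refl; sym; trans; cong)

private
  variable
    n s r : ℕ

least-witness : {P : ℕ → Set} → Decidable P → ∀ m → P m → ∃[ d ] P d × (∀ e → P e → d ≤ e)
least-witness P? zero p = zero , p , λ _ _ → z≤n
least-witness P? (suc m) p with P? zero
... | yes p₀ = zero , p₀ , λ _ _ → z≤n
... | no ¬p₀ with least-witness (λ e → P? (suc e)) m p
...   | d , pd , d-least = suc d , pd , λ
  { zero  p₀ → ⊥-elim (¬p₀ p₀)
  ; (suc e) pe → s≤s (d-least e pe) }

any-function? : ∀ n {m} {P : (Fin n → Fin m) → Set} →
  (∀ {f g} → f ≗ g → P f → P g) → Decidable P → Dec (∃ P)
any-function? zero {P = P} resp P? = map′ (λ p → _ , p) (λ (f , pf) → resp (λ ()) pf) (P? λ ())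
any-function? (suc n) {P = P} resp P? =
  map′ (λ (x , g , p) → x ∷ g , p)
       (λ (f , pf) → head f , tail f , resp head∷tail pf)
       (any? λ x → any-function? n (λ f≗g → resp (cons-cong f≗g)) (λ g → P? (x ∷ g)))
  where
  head∷tail : ∀ {f : Fin (suc n) → _} → f ≗ head f ∷ tail f
  head∷tail zero    = refl
  head∷tail (suc i) = refl
  cons-cong : ∀ {x} {f g : Fin n → _} → f ≗ g → x ∷ f ≗ x ∷ g
  cons-cong f≗g zero    = refl
  cons-cong f≗g (suc i) = f≗g i

ceilDiv-monoˡ-≤ : ∀ {d d′} m → d ≤ d′ → ceilDiv d m ≤ ceilDiv d′ m
ceilDiv-monoˡ-≤ zero    d≤d′ = z≤n
ceilDiv-monoˡ-≤ (suc m) d≤d′ = /-monoˡ-≤ (suc m) (+-monoˡ-≤ m d≤d′)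

empty⇒chromaticNumber-0 : (G : Hyp) → ¬ Vertex G → ¬ HEdge G → IsChromaticNumber G 0
empty⇒chromaticNumber-0 G ¬v ¬e = ((λ v → ⊥-elim (¬v v)) , λ e → ⊥-elim (¬e e)) , λ _ _ → z≤n

chromaticNumber-0⇒empty : (G : Hyp) → IsChromaticNumber G 0 → ¬ Vertex G
chromaticNumber-0⇒empty G ((c , _) , _) v with c v
... | ()

noStableEdge⇒χ-KG≡0 : (H : Hypergraph n) → (∀ {A} → edge H A → ¬ Stable n s A) →
  IsChromaticNumber (KG (suc r) (stablePart s H)) 0
noStableEdge⇒χ-KG≡0 H unstable =
  empty⇒chromaticNumber-0 _ no-vertex (λ (e , _) → no-vertex (e zero))
  where
  no-vertex : ¬ Edge (stablePart _ H)
  no-vertex (A , e , stable) = unstable e stable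

χ-KG≡0⇒noStableEdge : (H : Hypergraph n) → IsChromaticNumber (KG r (stablePart s H)) 0 →
  ∀ {A} → edge H A → ¬ Stable n s A
χ-KG≡0⇒noStableEdge H χ≡0 e stable = chromaticNumber-0⇒empty _ χ≡0 (_ , e , stable)

colorabilityDefect-exists : (H : Hypergraph n) → (∀ S → Dec (ColorableOutside H (suc r) S)) →
  ∃ (IsColorabilityDefect (suc r) H)
colorabilityDefect-exists {n} H col? =
  let d , (S , ∣S∣≡d , col) , d-least = least-witness defect? n (⊤ , ∣⊤∣≡n n , col-⊤)
  in d , (S , ∣S∣≡d , col) , λ S′ col′ → d-least ∣ S′ ∣ (S′ , refl , col′)
  where
  defect? : Decidable λ d → ∃ λ S → ∣ S ∣ ≡ d × ColorableOutside H _ S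
  defect? d = anySubset? λ S → (∣ S ∣ ≟ℕ d) ×-dec col? S
  col-⊤ : ColorableOutside H _ ⊤
  col-⊤ = (λ _ → zero) , λ A e outside _ →
    let v , v∈A = nonempty H e in outside v v∈A ∈⊤

colorabilityDefect-mono : {G H : Hypergraph n} →
  (∀ S → ColorableOutside G r S → ColorableOutside H r S) →
  ∀ {d d′} → IsColorabilityDefect r H d → IsColorabilityDefect r G d′ → d ≤ d′
colorabilityDefect-mono G⇒H (_ , d-least) ((S , refl , col) , _) = d-least S (G⇒H S col)

StableDistance : (n s : ℕ) → Fin n → Fin n → Set
StableDistance n s i j = s ≤ ∣ toℕ i - toℕ j ∣ × ∣ toℕ i - toℕ j ∣ ≤ n ∸ s

stableDistance? : ∀ n s (i j : Fin n) → Dec (StableDistance n s i j)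
stableDistance? n s i j = (s ≤? ∣ toℕ i - toℕ j ∣) ×-dec (∣ toℕ i - toℕ j ∣ ≤? n ∸ s)

∣⁅i⁆∪⁅j⁆∣≡2 : {i j : Fin n} → i ≢ j → ∣ ⁅ i ⁆ ∪ ⁅ j ⁆ ∣ ≡ 2
∣⁅i⁆∪⁅j⁆∣≡2 {i = zero}  {zero}  i≢j = ⊥-elim (i≢j refl)
∣⁅i⁆∪⁅j⁆∣≡2 {i = zero}  {suc j} i≢j = cong suc (trans (cong ∣_∣ (∪-identityˡ ⁅ j ⁆)) (∣⁅x⁆∣≡1 j))
∣⁅i⁆∪⁅j⁆∣≡2 {i = suc i} {zero}  i≢j = cong suc (trans (cong ∣_∣ (∪-identityʳ ⁅ i ⁆)) (∣⁅x⁆∣≡1 i))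
∣⁅i⁆∪⁅j⁆∣≡2 {i = suc i} {suc j} i≢j = ∣⁅i⁆∪⁅j⁆∣≡2 (λ i≡j → i≢j (cong suc i≡j))

∈⁅i⁆∪⁅j⁆⁻ : {i j v : Fin n} → v ∈ ⁅ i ⁆ ∪ ⁅ j ⁆ → v ≡ i ⊎ v ≡ j
∈⁅i⁆∪⁅j⁆⁻ {i = i} {j} = Sum.map (x∈⁅y⁆⇒x≡y i) (x∈⁅y⁆⇒x≡y j) ∘ x∈p∪q⁻ ⁅ i ⁆ ⁅ j ⁆

ProperOnUnstablePairs : (n s r : ℕ) → Subset n → (Fin n → Fin r) → Set
ProperOnUnstablePairs n s r S c =
  ∀ i j → i ∉ S → j ∉ S → i ≢ j → ¬ StableDistance n s i j → c i ≢ c j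

properOnUnstablePairs? : ∀ S → Decidable (ProperOnUnstablePairs n s r S)
properOnUnstablePairs? {n} {s} S c = all? λ i → all? λ j →
  ¬? (i ∈? S) →-dec ¬? (j ∈? S) →-dec ¬? (i ≟ j) →-dec
  ¬? (stableDistance? n s i j) →-dec ¬? (c i ≟ c j)

properOnUnstablePairs-resp : ∀ {S} {c c′ : Fin n → Fin r} → c ≗ c′ →
  ProperOnUnstablePairs n s r S c → ProperOnUnstablePairs n s r S c′
properOnUnstablePairs-resp c≗c′ proper i j i∉S j∉S i≢j unstable c′i≡c′j =
  proper i j i∉S j∉S i≢j unstable (trans (c≗c′ i) (trans c′i≡c′j (sym (c≗c′ j))))

colorableOutside-F⇒properOnUnstablePairs : ∀ {S} →
  ColorableOutside (F n s) r S → ∃ (ProperOnUnstablePairs n s r S)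
colorableOutside-F⇒properOnUnstablePairs {S = S} (c , proper) =
  c , λ i j i∉S j∉S i≢j unstable ci≡cj →
    proper (⁅ i ⁆ ∪ ⁅ j ⁆)
      (∣⁅i⁆∪⁅j⁆∣≡2 i≢j , λ stable → unstable (stable i j (∈-left i j) (∈-right i j) i≢j))
      (outside i∉S j∉S) (monochromatic ci≡cj)
  where
  ∈-left : ∀ i j → i ∈ ⁅ i ⁆ ∪ ⁅ j ⁆
  ∈-left i j = x∈p∪q⁺ (inj₁ (x∈⁅x⁆ i))
  ∈-right : ∀ i j → j ∈ ⁅ i ⁆ ∪ ⁅ j ⁆
  ∈-right i j = x∈p∪q⁺ (inj₂ (x∈⁅x⁆ j))
  outside : ∀ {i j} → i ∉ S → j ∉ S → ∀ v → v ∈ ⁅ i ⁆ ∪ ⁅ j ⁆ → v ∉ S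
  outside i∉S j∉S v v∈ with ∈⁅i⁆∪⁅j⁆⁻ v∈
  ... | inj₁ refl = i∉S
  ... | inj₂ refl = j∉S
  monochromatic : ∀ {i j} → c i ≡ c j →
    ∀ v w → v ∈ ⁅ i ⁆ ∪ ⁅ j ⁆ → w ∈ ⁅ i ⁆ ∪ ⁅ j ⁆ → c v ≡ c w
  monochromatic ci≡cj v w v∈ w∈ with ∈⁅i⁆∪⁅j⁆⁻ v∈ | ∈⁅i⁆∪⁅j⁆⁻ w∈
  ... | inj₁ refl | inj₁ refl = refl
  ... | inj₁ refl | inj₂ refl = ci≡cj
  ... | inj₂ refl | inj₁ refl = sym ci≡cj
  ... | inj₂ refl | inj₂ refl = refl

-- A monochromatic unstable set off S would contain an unstable pair off S of equal colour.
properOnUnstablePairs⇒colorableOutside : ∀ {S} (H : Hypergraph n) →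
  (∀ {A} → edge H A → ¬ Stable n s A) →
  ∃ (ProperOnUnstablePairs n s r S) → ColorableOutside H r S
properOnUnstablePairs⇒colorableOutside {n} {s} H unstable (c , proper) =
  c , λ A e outside monochromatic → unstable e λ i j i∈A j∈A i≢j →
    decidable-stable (stableDistance? n s i j) λ unstable-ij →
      proper i j (outside i i∈A) (outside j j∈A) i≢j unstable-ij (monochromatic i j i∈A j∈A)

colorableOutside-F? : ∀ S → Dec (ColorableOutside (F n s) r S)
colorableOutside-F? {n} {s} S =
  map′ (properOnUnstablePairs⇒colorableOutside (F n s) proj₂)
       colorableOutside-F⇒properOnUnstablePairs
       (any-function? n properOnUnstablePairs-resp (properOnUnstablePairs? S))

lemma2p2 : (r s k n : ℕ) → 2 ≤ r → 1 ≤ s → 1 ≤ k → 1 ≤ n →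
    (∃[ H ] Cond {n} r s k H) ⇔ Cond r s k (F n s)
lemma2p2 (suc r) s k n (s≤s _) _ _ _ = mk⇔ H⇒F (F n s ,_)
  where
  H⇒F : ∃[ H ] Cond (suc r) s k H → Cond (suc r) s k (F n s)
  H⇒F (H , χ≡0 , d , cd-H , k≤⌈d/r⌉) =
    let d′ , cd-F = colorabilityDefect-exists (F n s) colorableOutside-F?
    in noStableEdge⇒χ-KG≡0 (F n s) proj₂ , d′ , cd-F ,
       ≤-trans k≤⌈d/r⌉
         (ceilDiv-monoˡ-≤ r (colorabilityDefect-mono {G = F n s} {H = H} F⇒H cd-H cd-F))
    where
    F⇒H : ∀ S → ColorableOutside (F n s) (suc r) S → ColorableOutside H (suc r) S
    F⇒H S = properOnUnstablePairs⇒colorableOutside H (χ-KG≡0⇒noStableEdge H χ≡0)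
          ∘ colorableOutside-F⇒properOnUnstablePairs
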